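{- If $G$ is a connected graph of order $n(G)$, then $$\chi_\mu(G)\le \left\lceil\frac{n(G)-\mu(G)+2}{2}\right\rceil.$$
   Context: For a connected graph $G$ and $S\subseteq V(G)$, two vertices $x,y\in S$ are $S$-visible if there is a shortest $x,y$-path $P$ in $G$ with $V(P)\cap S=\{x,y\}$. $S$ is a mutual-visibility set if any two vertices of $S$ are $S$-visible. The mutual-visibility number $\mu(G)$ is the largest cardinality of a mutual-visibility set. A mutual-visibility coloring of $G$ is a partition of $V(G)$ into mutual-visibility sets, and the mutual-visibility chromatic number $\chi_\mu(G)$ is the smallest number of classes in such a partition. -}

module Defs where

open import Data.Nat using (ℕ; zero; suc; _≤_)
open import Data.Fin using (Fin)
open import Data.Fin.Subset using (Subset; _∈_; ∣_∣)
open import Data.Bool using (Bool; T)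
open import Data.List using (List; []; _∷_)
open import Data.List.Relation.Unary.All using (All)
open import Data.Product using (Σ; ∃; _×_)
open import Data.Sum using (_⊎_)
open import Relation.Binary.PropositionalEquality using (_≡_)
open import Relation.Nullary using (¬_; does)
open import Data.Vec using (tabulate)
open import Data.Fin using (_≟_)

record Graph (n : ℕ) : Set where
  field
    adj   : Fin n → Fin n → Bool
    sym   : ∀ x y → adj x y ≡ adj y x
    irrefl : ∀ x → adj x x ≡ Data.Bool.false

open Graph public

Adj : ∀ {n} → Graph n → Fin n → Fin n → Set
Adj G x y = T (adj G x y)

data Walk {n : ℕ} (G : Graph n) : Fin n → Fin n → Set where
  nil  : ∀ {x} → Walk G x x
  cons : ∀ {x y z} → Adj G x y → Walk G y z → Walk G x z

len : ∀ {n} {G : Graph n} {x y} → Walk G x y → ℕ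
len nil        = zero
len (cons _ w) = suc (len w)

verts : ∀ {n} {G : Graph n} {x y} → Walk G x y → List (Fin n)
verts {x = x} nil           = x ∷ []
verts {x = x} (cons _ w)    = x ∷ verts w

Connected : ∀ {n} → Graph n → Set
Connected G = ∀ x y → Walk G x y

-- A shortest x,y-walk: no x,y-walk is shorter (such a walk is
-- necessarily a path, i.e. a shortest x,y-path).
Shortest : ∀ {n} {G : Graph n} {x y} → Walk G x y → Set
Shortest {G = G} {x} {y} P = ∀ (Q : Walk G x y) → len P ≤ len Q

Visible : ∀ {n} → Graph n → Subset n → Fin n → Fin n → Set
Visible G S x y =
  Σ (Walk G x y) λ P → Shortest P ×
    All (λ v → v ∈ S → v ≡ x ⊎ v ≡ y) (verts P)

MutVis : ∀ {n} → Graph n → Subset n → Set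
MutVis G S = ∀ x y → x ∈ S → y ∈ S → Visible G S x y

IsMu : ∀ {n} → Graph n → ℕ → Set
IsMu G m = (∃ λ S → MutVis G S × ∣ S ∣ ≡ m)
         × (∀ S → MutVis G S → ∣ S ∣ ≤ m)

colourClass : ∀ {n k} → (Fin n → Fin k) → Fin k → Subset n
colourClass c i = tabulate λ v → does (c v ≟ i)

-- A mutual-visibility colouring with (at most) k colours: a partition of
-- V(G) into k classes (empty classes allowed; this does not change the
-- minimum, as the empty set is a mutual-visibility set).
MVColouring : ∀ {n} → Graph n → ℕ → Set
MVColouring {n} G k = Σ (Fin n → Fin k) λ c → ∀ i → MutVis G (colourClass c i)

IsChiMu : ∀ {n} → Graph n → ℕ → Set
IsChiMu G c = MVColouring G c × (∀ k → MVColouring G k → c ≤ k)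

-- Colour a largest mutual-visibility set S with one colour and split the
-- remaining n − μ(G) vertices into pairs, each pair receiving a new colour.
-- In a connected graph every set of at most two vertices is a
-- mutual-visibility set (any shortest path between them will do), so this
-- is a mutual-visibility colouring with 1 + ⌈(n − μ(G))/2⌉ colours.
module Submission where

open import Defs hiding (sym)
open import Data.Nat using (ℕ; zero; suc; _≤_; _<_; _∸_; _+_; z≤n; s≤s; ⌊_/2⌋; ⌈_/2⌉; anyUpTo?)
open import Data.Nat.Induction using (<-rec)
open import Data.Nat.Properties using (≤-refl; <-≤-trans; ≮⇒≥; +-comm; ⌈n/2⌉-mono; module ≤-Reasoning)
  renaming (suc-injective to ℕ-suc-injective)
open import Data.Fin as Fin using (Fin; toℕ; fromℕ<; _≟_)
open import Data.Fin.Properties using (any?; toℕ-fromℕ<; suc-injective)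
open import Data.Fin.Subset using (Subset; _∈_; _⊆_; ∁; ∣_∣; inside; outside)
open import Data.Fin.Subset.Properties using (_∈?_; x∉p⇒x∈∁p; ∣∁p∣≡n∸∣p∣)
open import Data.Vec using (_∷_; here; there)
open import Data.Vec.Properties using ([]=⇒lookup; lookup∘tabulate)
open import Data.Bool using (T?)
open import Data.List.Relation.Unary.All as All using (_∷_; [])
open import Data.Product using (∃; _×_; _,_)
open import Data.Sum using (_⊎_; inj₁; inj₂)
open import Data.Empty using (⊥-elim)
open import Function using (_∘_)
open import Relation.Unary using (Pred; Decidable)
open import Relation.Nullary using (¬_; Dec; yes; no; does; _×-dec_; _⊎-dec_; map′)
open import Relation.Binary.PropositionalEquality using (_≡_; _≢_; refl; sym; trans; cong)

Least : ∀ {p} → Pred ℕ p → Set p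
Least P = ∃ λ m → P m × (∀ {j} → j < m → ¬ P j)

least : ∀ {p} {P : Pred ℕ p} → Decidable P → ∀ k → P k → Least P
least {P = P} P? = <-rec (λ k → P k → Least P) step
  where
  step : ∀ k → (∀ {j} → j < k → P j → Least P) → P k → Least P
  step k rec Pk with anyUpTo? P? k
  ... | yes (j , j<k , Pj) = rec j<k Pj
  ... | no none            = k , Pk , λ j<k Pj → none (_ , j<k , Pj)

WalkWithin : ∀ {n} → Graph n → ℕ → Fin n → Fin n → Set
WalkWithin G k x y = ∃ λ (w : Walk G x y) → len w ≤ k

walkWithin? : ∀ {n} (G : Graph n) k x y → Dec (WalkWithin G k x y)
walkWithin? G zero x y =
  map′ (λ { refl → nil , z≤n }) (λ { (nil , _) → refl ; (cons _ _ , ()) }) (x ≟ y)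
walkWithin? G (suc k) x y =
  map′ extend split
       (x ≟ y ⊎-dec any? λ z → T? (adj G x z) ×-dec walkWithin? G k z y)
  where
  extend : x ≡ y ⊎ ∃ (λ z → Adj G x z × WalkWithin G k z y) → WalkWithin G (suc k) x y
  extend (inj₁ refl)               = nil , z≤n
  extend (inj₂ (_ , a , w , |w|≤k)) = cons a w , s≤s |w|≤k
  split : WalkWithin G (suc k) x y → x ≡ y ⊎ ∃ (λ z → Adj G x z × WalkWithin G k z y)
  split (nil , _)               = inj₁ refl
  split (cons a w , s≤s |w|≤k) = inj₂ (_ , a , w , |w|≤k)

shortestWalk : ∀ {n} {G : Graph n} → Connected G → ∀ x y → ∃ λ (P : Walk G x y) → Shortest P
shortestWalk {G = G} conn x y with least (λ k → walkWithin? G k x y) _ (conn x y , ≤-refl)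
... | _ , (P , |P|≤m) , noShorter = P , λ Q → ≮⇒≥ λ |Q|<|P| →
  noShorter (<-≤-trans |Q|<|P| |P|≤m) (Q , ≤-refl)

MutVis-⊆ : ∀ {n} {G : Graph n} {A B : Subset n} → A ⊆ B → MutVis G B → MutVis G A
MutVis-⊆ A⊆B visB x y x∈A y∈A with visB x y (A⊆B x∈A) (A⊆B y∈A)
... | P , shortest , avoidsB = P , shortest , All.map (λ onlyEnds → onlyEnds ∘ A⊆B) avoidsB

AtMostTwo : ∀ {n} → Subset n → Set
AtMostTwo C = ∀ {x y v} → x ∈ C → y ∈ C → v ∈ C → x ≢ y → v ≡ x ⊎ v ≡ y

atMostTwo⇒MutVis : ∀ {n} {G : Graph n} → Connected G → ∀ {C} → AtMostTwo C → MutVis G C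
atMostTwo⇒MutVis conn C≤2 x y x∈C y∈C with x ≟ y
... | yes refl = nil , (λ _ → z≤n) , (λ _ → inj₁ refl) ∷ []
... | no x≢y with shortestWalk conn x y
...   | P , shortest = P , shortest , All.tabulate λ _ v∈C → C≤2 x∈C y∈C v∈C x≢y

rank : ∀ {n} → Subset n → Fin n → ℕ
rank (_ ∷ p)       Fin.zero    = 0
rank (inside ∷ p)  (Fin.suc v) = suc (rank p v)
rank (outside ∷ p) (Fin.suc v) = rank p v

rank-< : ∀ {n} {p : Subset n} {v} → v ∈ p → rank p v < ∣ p ∣
rank-< {p = inside ∷ p}  here        = s≤s z≤n
rank-< {p = inside ∷ p}  (there v∈p) = s≤s (rank-< v∈p)
rank-< {p = outside ∷ p} (there v∈p) = rank-< v∈p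

rank-injective : ∀ {n} {p : Subset n} {u v} → u ∈ p → v ∈ p → rank p u ≡ rank p v → u ≡ v
rank-injective                   here        here        _  = refl
rank-injective {p = inside ∷ p}  here        (there _)   ()
rank-injective {p = inside ∷ p}  (there _)   here        ()
rank-injective {p = inside ∷ p}  (there u∈p) (there v∈p) eq =
  cong Fin.suc (rank-injective u∈p v∈p (ℕ-suc-injective eq))
rank-injective {p = outside ∷ p} (there u∈p) (there v∈p) eq =
  cong Fin.suc (rank-injective u∈p v∈p eq)

twin : ℕ → ℕ
twin 0             = 1
twin 1             = 0
twin (suc (suc m)) = suc (suc (twin m))

⌊/2⌋-fibre : ∀ a c → ⌊ a /2⌋ ≡ ⌊ c /2⌋ → a ≡ c ⊎ a ≡ twin c
⌊/2⌋-fibre 0             0             _  = inj₁ refl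
⌊/2⌋-fibre 0             1             _  = inj₂ refl
⌊/2⌋-fibre 1             0             _  = inj₂ refl
⌊/2⌋-fibre 1             1             _  = inj₁ refl
⌊/2⌋-fibre (suc (suc a)) (suc (suc c)) eq with ⌊/2⌋-fibre a c (ℕ-suc-injective eq)
... | inj₁ refl = inj₁ refl
... | inj₂ refl = inj₂ refl
⌊/2⌋-fibre 0             (suc (suc _)) ()
⌊/2⌋-fibre 1             (suc (suc _)) ()
⌊/2⌋-fibre (suc (suc _)) 0             ()
⌊/2⌋-fibre (suc (suc _)) 1             ()

⌊/2⌋-atMostTwoToOne : ∀ {a b c} → ⌊ a /2⌋ ≡ ⌊ c /2⌋ → ⌊ b /2⌋ ≡ ⌊ c /2⌋ → a ≢ b → c ≡ a ⊎ c ≡ b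
⌊/2⌋-atMostTwoToOne {a} {b} {c} ac bc a≢b with ⌊/2⌋-fibre a c ac | ⌊/2⌋-fibre b c bc
... | inj₁ refl | _         = inj₁ refl
... | _         | inj₁ refl = inj₂ refl
... | inj₂ refl | inj₂ refl = ⊥-elim (a≢b refl)

∈-colourClass : ∀ {n k} (c : Fin n → Fin k) i {v} → v ∈ colourClass c i → c v ≡ i
∈-colourClass c i {v} v∈class
  with c v ≟ i | trans (sym (lookup∘tabulate (λ w → does (c w ≟ i)) v)) ([]=⇒lookup v∈class)
... | yes cv≡i | _ = cv≡i

module PairUp {n : ℕ} (S : Subset n) where

  colours : ℕ
  colours = suc ⌈ ∣ ∁ S ∣ /2⌉

  -- S gets colour 0; the vertices outside S of rank 2j and 2j+1 in ∁ S get colour j+1.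
  colour : Fin n → Fin colours
  colour v with v ∈? S
  ... | yes _  = Fin.zero
  ... | no v∉S = Fin.suc (fromℕ< (⌈n/2⌉-mono (rank-< (x∉p⇒x∈∁p v∉S))))

  colour≡0⇒∈ : ∀ {v} → colour v ≡ Fin.zero → v ∈ S
  colour≡0⇒∈ {v} _ with v ∈? S
  ... | yes v∈S = v∈S

  colour≡suc⇒ : ∀ {v j} → colour v ≡ Fin.suc j → v ∈ ∁ S × ⌊ rank (∁ S) v /2⌋ ≡ toℕ j
  colour≡suc⇒ {v} eq with v ∈? S
  ... | no v∉S = x∉p⇒x∈∁p v∉S , trans (sym (toℕ-fromℕ< _)) (cong toℕ (suc-injective eq))

  class0⊆S : colourClass colour Fin.zero ⊆ S
  class0⊆S = colour≡0⇒∈ ∘ ∈-colourClass colour Fin.zero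

  classSuc⇒ : ∀ {j v} → v ∈ colourClass colour (Fin.suc j) → v ∈ ∁ S × ⌊ rank (∁ S) v /2⌋ ≡ toℕ j
  classSuc⇒ {j} = colour≡suc⇒ ∘ ∈-colourClass colour (Fin.suc j)

  classSuc-atMostTwo : ∀ j → AtMostTwo (colourClass colour (Fin.suc j))
  classSuc-atMostTwo j x∈C y∈C v∈C x≢y with classSuc⇒ x∈C | classSuc⇒ y∈C | classSuc⇒ v∈C
  ... | x∈∁S , x↦j | y∈∁S , y↦j | v∈∁S , v↦j
    with ⌊/2⌋-atMostTwoToOne (trans x↦j (sym v↦j)) (trans y↦j (sym v↦j))
                             (x≢y ∘ rank-injective x∈∁S y∈∁S)
  ... | inj₁ v≡x = inj₁ (rank-injective v∈∁S x∈∁S v≡x)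
  ... | inj₂ v≡y = inj₂ (rank-injective v∈∁S y∈∁S v≡y)

  mvColouring : ∀ {G} → Connected G → MutVis G S → MVColouring G colours
  mvColouring conn visS = colour , λ
    { Fin.zero    → MutVis-⊆ class0⊆S visS
    ; (Fin.suc j) → atMostTwo⇒MutVis conn (classSuc-atMostTwo j) }

proposition5p3 : ∀ (n : ℕ) (G : Graph n) → Connected G →
                 ∀ (m c : ℕ) → IsMu G m → IsChiMu G c →
                 c ≤ ⌈ (n ∸ m) + 2 /2⌉
proposition5p3 n G conn m c ((S , visS , ∣S∣≡m) , _) (_ , χ-minimal) = begin
  c                          ≤⟨ χ-minimal _ (PairUp.mvColouring S conn visS) ⟩
  ⌈ 2 + ∣ ∁ S ∣ /2⌉          ≡⟨ cong (λ k → ⌈ 2 + k /2⌉) (trans (∣∁p∣≡n∸∣p∣ S) (cong (n ∸_) ∣S∣≡m)) ⟩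
  ⌈ 2 + (n ∸ m) /2⌉          ≡⟨ cong ⌈_/2⌉ (+-comm 2 (n ∸ m)) ⟩
  ⌈ (n ∸ m) + 2 /2⌉          ∎
  where open ≤-Reasoning
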